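{- Let $n$ be a positive integer and $m=2\lfloor\frac{n-1}3\rfloor+1$. For any integers $l_0,\dots,l_{m-1}$, the set $\{\gamma\rho(\nabla B^{k}_{2n-1,l_k}): k\in\{0,\dots,m-1\}\}$ is a basis of $\mathcal{RPT}(n)$. Moreover, for every $k\in\{0,\dots,m-1\}$, $$\gamma\rho(\nabla B^{k}_{2n-1,l_k})=\left(\binom{l_k+j-i+n-1}{k+1-i}+\binom{l_k+n-j}{k+i-j-n+1}+\binom{l_k+i-1}{k+j-n}\bmod 2\right)_{1\le j\le i\le n}.$$
   Context: Binomial coefficients $\binom{a}{b}$ are defined for all integers $a,b$ by $\binom{a}{0}=1$, $\binom{0}{b}=0$ for $b>0$, and $\binom{a}{b}=\binom{a-1}{b-1}+\binom{a-1}{b}$ for all $a,b\in\mathbb{Z}$. A binary Steinhaus triangle of size $N$ is an array $(a_{i,j})_{1\le i\le j\le N}$ of elements of $\{0,1\}$ with $a_{i,j}\equiv a_{i-1,j-1}+a_{i-1,j}\pmod 2$ for $2\le i\le j\le N$. $\nabla S$ is the triangle with first row $S$. On these triangles, $r((a_{i,j}))=(a_{j-i+1,N-i+1})$ and $\rho=r^2+r+\mathrm{id}$. A generalized Pascal triangle of size $n$ is an array $(a_{i,j})_{1\le j\le i\le n}$ of elements of $\{0,1\}$ with $a_{i,j}\equiv a_{i-1,j-1}+a_{i-1,j}\pmod 2$ for $2\le j<i\le n$. These form a vector space $\mathcal{PT}(n)$ over $\mathbb{Z}/2\mathbb{Z}$. The map $\gamma$ sends a Steinhaus triangle $(a_{i,j})$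 of size $2n-1$ to $(a_{i,n-1+j})_{1\le j\le i\le n}\in\mathcal{PT}(n)$. On $\mathcal{PT}(n)$, the rotation is $r'((a_{i,j}))=(a_{n+j-i,n+1-i})_{1\le j\le i\le n}$, and $\mathcal{RPT}(n)=\{\Delta\in\mathcal{PT}(n): r'(\Delta)=\Delta\}$. $B^{k}_{N,l}=\left(\binom{l+j-1}{k}\bmod 2\right)_{1\le j\le N}$. -}

module Defs where

open import Data.Nat using (ℕ; zero; suc; _∸_; _≤_) renaming (_+_ to _+ℕ_; _*_ to _*ℕ_)
open import Data.Nat.DivMod using (_/_)
open import Data.Integer as ℤ using (ℤ; +_; -[1+_]; _+_; _-_; 0ℤ; 1ℤ)
open import Data.Integer.DivMod using (_%ℕ_)
open import Data.Nat using (_≡ᵇ_)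
open import Data.Bool using (Bool; true; false; _xor_; _∧_)
open import Data.Fin using (Fin) renaming (zero to fzero; suc to fsuc)
open import Data.Product using (Σ; _×_)
open import Function using (_∘_)
open import Relation.Binary.PropositionalEquality using (_≡_)

-- Binomial coefficients for all integers a, b, defined by
--   C(a,0)=1, C(0,b)=0 (b>0), C(a,b)=C(a-1,b-1)+C(a-1,b).
-- The Pascal rule at b = 0 forces C(a,-1)=0 for all a, and inductively
-- C(a,b)=0 for all b<0.  For b ≥ 0 we run the recursion forwards for
-- a ≥ 0 and backwards (C(a-1,b+1) = C(a,b+1) - C(a-1,b)) for a < 0.

binPos : ℕ → ℕ → ℤ
binPos a zero = 1ℤ
binPos zero (suc b) = 0ℤ
binPos (suc a) (suc b) = binPos a b + binPos a (suc b)

-- binNeg b n = C(-(n+1), b)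
binNeg : ℕ → ℕ → ℤ
binNeg zero n = 1ℤ
binNeg (suc b) zero = binPos 0 (suc b) - binNeg b zero
binNeg (suc b) (suc n) = binNeg (suc b) n - binNeg b (suc n)

binomℕ : ℤ → ℕ → ℤ
binomℕ (+ a) b = binPos a b
binomℕ -[1+ n ] b = binNeg b n

binom : ℤ → ℤ → ℤ
binom a (+ b) = binomℕ a b
binom a -[1+ _ ] = 0ℤ

-- reduction mod 2, as an element of ℤ/2 = Bool (true = 1)
bit : ℤ → Bool
bit z = (z %ℕ 2) ≡ᵇ 1

-- Triangular arrays over ℤ/2ℤ, indexed 1-based by naturals
-- (only entries inside the relevant index range matter).

Tri : Set
Tri = ℕ → ℕ → Bool

nabla : (ℕ → Bool) → Tri
nabla S zero j = false
nabla S (suc zero) j = S j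
nabla S (suc (suc i)) zero = false
nabla S (suc (suc i)) (suc j) = nabla S (suc i) j xor nabla S (suc i) (suc j)

B : ℕ → ℤ → (ℕ → Bool)
B k l j = bit (binom (l + + j - 1ℤ) (+ k))

rotS : ℕ → Tri → Tri
rotS N a i j = a (suc (j ∸ i)) (suc (N ∸ i))

rho : ℕ → Tri → Tri
rho N a i j = (rotS N (rotS N a) i j xor rotS N a i j) xor a i j

gamma : ℕ → Tri → Tri
gamma n a i j = a i ((n ∸ 1) +ℕ j)

IsPT : ℕ → Tri → Set
IsPT n a = ∀ i j → 2 ≤ j → j Data.Nat.< i → i ≤ n →
  a i j ≡ (a (i ∸ 1) (j ∸ 1) xor a (i ∸ 1) j)

_≈[_]_ : Tri → ℕ → Tri → Set
a ≈[ n ] b = ∀ i j → 1 ≤ j → j ≤ i → i ≤ n → a i j ≡ b i j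

rotP : ℕ → Tri → Tri
rotP n a i j = a ((n +ℕ j) ∸ i) (suc n ∸ i)

IsRPT : ℕ → Tri → Set
IsRPT n a = IsPT n a × (rotP n a ≈[ n ] a)

zeroTri : Tri
zeroTri i j = false

lincomb : ∀ {m} → (Fin m → Bool) → (Fin m → Tri) → Tri
lincomb {zero} c v i j = false
lincomb {suc m} c v i j = (c fzero ∧ v fzero i j) xor lincomb (c ∘ fsuc) (v ∘ fsuc) i j

IsBasisRPT : (n : ℕ) {m : ℕ} → (Fin m → Tri) → Set
IsBasisRPT n {m} v =
  (∀ k → IsRPT n (v k))
  × (∀ (c : Fin m → Bool) → lincomb c v ≈[ n ] zeroTri → ∀ k → c k ≡ false)
  × (∀ (Δ : Tri) → IsRPT n Δ → Σ (Fin m → Bool) λ c → lincomb c v ≈[ n ] Δ)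

mOf : ℕ → ℕ
mOf n = 2 *ℕ ((n ∸ 1) / 3) +ℕ 1

fam : (n : ℕ) {m : ℕ} → (Fin m → ℤ) → Fin m → Tri
fam n l k = gamma n (rho (2 *ℕ n ∸ 1) (nabla (B (Data.Fin.toℕ k) (l k))))

module Submission where

-- Write P a b for C(a, b) mod 2; it obeys Pascal's rule for all
-- integers a, b.  (1) The Steinhaus triangle ∇B^k_l has entries
-- P (l+c-r) (k+1-r); reading off r and r² of it gives the closed form above,
-- one summand per term of ρ = r² + r + id.  (2) Each summand satisfies the
-- Pascal recurrence and r' permutes the three summands cyclically, so the
-- closed form lies in RPT(n).  (3) An RPT(n) triangle vanishing at the m
-- pivots (s+1, ⌊s/2⌋+1) vanishes: its interior is an RPT(n-3) triangle
-- vanishing at its pivots, and rotation spreads the first column over the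
-- boundary.  (4) At the pivots the closed forms give a unitriangular matrix
-- over ℤ/2, which yields independence directly and, with (3), spanning.

open import Defs
open import Data.Nat as ℕ using (ℕ; zero; suc; z≤n; s≤s; _∸_; _≤_; _<_; _≡ᵇ_; ⌊_/2⌋; ⌈_/2⌉)
import Data.Nat.Properties as ℕ
open import Data.Nat.DivMod using (_/_; _%_; [m+n]%n≡m%n; m%n<n; m/n≡1+[m∸n]/n; m/n*n≤m)
open import Data.Nat.Tactic.RingSolver using () renaming (solve-∀ to ℕ-solve-∀)
open import Data.Integer as ℤ using (ℤ; +_; -[1+_]; _+_; _-_; -_; 0ℤ; 1ℤ; _⊖_)
import Data.Integer.Properties as ℤ
open import Data.Integer.Tactic.RingSolver using (solve-∀)
open import Data.Bool using (Bool; true; false; not; _xor_; _∧_)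
open import Algebra.Bundles using (CommutativeRing)
open import Data.Bool.Properties
  using (xor-comm; xor-assoc; xor-same; xor-identityʳ; ∧-identityʳ; ∧-zeroʳ; not-involutive; not-distribˡ-xor; xor-annihilates-not; xor-∧-commutativeRing)
open import Algebra.Properties.CommutativeSemigroup
  (CommutativeRing.+-commutativeSemigroup xor-∧-commutativeRing) using (interchange; xy∙z≈zx∙y; xy∙z≈zy∙x)
open import Data.Vec.Functional using (_∷_)
open import Data.Sum as Sum using (_⊎_; inj₁; inj₂)
open import Relation.Nullary using (yes; no)
open import Data.Fin using (Fin; toℕ; fromℕ<) renaming (zero to fzero; suc to fsuc)
open import Data.Product using (Σ; _×_; _,_; proj₁; proj₂)
open import Data.Fin.Properties using (toℕ<n; toℕ-fromℕ<)
open import Function using (_∘_)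
open import Relation.Binary.PropositionalEquality

parityℕ : ℕ → Bool
parityℕ zero = false
parityℕ (suc n) = not (parityℕ n)

parity : ℤ → Bool
parity (+ n) = parityℕ n
parity -[1+ n ] = parityℕ (suc n)

parityℕ-+ : ∀ m n → parityℕ (m ℕ.+ n) ≡ parityℕ m xor parityℕ n
parityℕ-+ zero n = refl
parityℕ-+ (suc m) n = trans (cong not (parityℕ-+ m n)) (not-distribˡ-xor (parityℕ m) _)

parity-⊖ : ∀ m n → parity (m ⊖ n) ≡ parityℕ m xor parityℕ n
parity-⊖ m zero = trans (cong parity (ℤ.⊖-≥ {m} z≤n)) (sym (xor-identityʳ (parityℕ m)))
parity-⊖ zero (suc n) = refl
parity-⊖ (suc m) (suc n) = begin
  parity (suc m ⊖ suc n)                 ≡⟨ cong parity (ℤ.[1+m]⊖[1+n]≡m⊖n m n) ⟩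
  parity (m ⊖ n)                         ≡⟨ parity-⊖ m n ⟩
  parityℕ m xor parityℕ n                ≡⟨ sym (xor-annihilates-not (parityℕ m) _) ⟩
  parityℕ (suc m) xor parityℕ (suc n)    ∎
  where open ≡-Reasoning

parity-+ : ∀ x y → parity (x + y) ≡ parity x xor parity y
parity-+ (+ m) (+ n) = parityℕ-+ m n
parity-+ (+ m) -[1+ n ] = parity-⊖ m (suc n)
parity-+ -[1+ m ] (+ n) = trans (parity-⊖ n (suc m)) (xor-comm (parityℕ n) _)
parity-+ -[1+ m ] -[1+ n ] = begin
  not (not (parityℕ (m ℕ.+ n)))              ≡⟨ not-involutive _ ⟩
  parityℕ (m ℕ.+ n)                          ≡⟨ parityℕ-+ m n ⟩
  parityℕ m xor parityℕ n                    ≡⟨ sym (xor-annihilates-not (parityℕ m) _) ⟩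
  parityℕ (suc m) xor parityℕ (suc n)        ∎
  where open ≡-Reasoning

parityℕ≡%2 : ∀ n → parityℕ n ≡ (n % 2 ≡ᵇ 1)
parityℕ≡%2 zero = refl
parityℕ≡%2 (suc zero) = refl
parityℕ≡%2 (suc (suc n)) =
  trans (not-involutive _) (trans (parityℕ≡%2 n) (cong (_≡ᵇ 1) (sym (trans (cong (_% 2) (ℕ.+-comm 2 n)) ([m+n]%n≡m%n n 2)))))

bit≡parity : ∀ z → bit z ≡ parity z
bit≡parity (+ n) = sym (parityℕ≡%2 n)
bit≡parity -[1+ n ] with suc n % 2 in eq | m%n<n (suc n) 2
... | zero | _ = sym (trans (parityℕ≡%2 (suc n)) (cong (_≡ᵇ 1) eq))
... | suc zero | _ = sym (trans (parityℕ≡%2 (suc n)) (cong (_≡ᵇ 1) eq))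
... | suc (suc r) | s≤s (s≤s ())

bit-+ : ∀ x y → bit (x + y) ≡ bit x xor bit y
bit-+ x y = trans (bit≡parity (x + y))
  (trans (parity-+ x y) (sym (cong₂ _xor_ (bit≡parity x) (bit≡parity y))))

xor-isolateˡ : ∀ x y z → z ≡ x xor y → x ≡ y xor z
xor-isolateˡ true true _ refl = refl
xor-isolateˡ true false _ refl = refl
xor-isolateˡ false true _ refl = refl
xor-isolateˡ false false _ refl = refl

xor-isolateʳ : ∀ x y z → z ≡ x xor y → y ≡ z xor x
xor-isolateʳ true true _ refl = refl
xor-isolateʳ true false _ refl = refl
xor-isolateʳ false true _ refl = refl
xor-isolateʳ false false _ refl = refl

y≡x+[y-x] : ∀ (x y : ℤ) → y ≡ x + (y - x)
y≡x+[y-x] = solve-∀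

x+1-1≡x : ∀ x → x + 1ℤ - 1ℤ ≡ x
x+1-1≡x = solve-∀

binomℕ-0 : ∀ a → binomℕ a 0 ≡ 1ℤ
binomℕ-0 (+ n) = refl
binomℕ-0 -[1+ n ] = refl

-- Pascal's rule holds for all integers a, b (the defining recursion of
-- Defs runs backwards for negative a, and binom vanishes for b < 0).
binom-pascal : ∀ a b → binom a b ≡ binom (a - 1ℤ) (b - 1ℤ) + binom (a - 1ℤ) b
binom-pascal a -[1+ q ] = refl
binom-pascal a (+ zero) =
  trans (binomℕ-0 a) (sym (trans (ℤ.+-identityˡ _) (binomℕ-0 (a - 1ℤ))))
binom-pascal (+ suc a) (+ suc b) = refl
binom-pascal (+ zero) (+ suc b) = y≡x+[y-x] (binNeg b 0) 0ℤ
binom-pascal -[1+ q ] (+ suc b) rewrite ℕ.+-identityʳ q = y≡x+[y-x] (binNeg b (suc q)) (binNeg (suc b) q)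

+-∸ : ∀ {m n} → n ≤ m → + (m ∸ n) ≡ + m - + n
+-∸ {m} {n} n≤m = sym (trans (ℤ.m-n≡m⊖n m n) (ℤ.⊖-≥ n≤m))

opaque
  -- P a b is the parity of the binomial coefficient C(a, b).  It is kept
  -- opaque: all that is used of it is the interface proved in this block.
  P : ℤ → ℤ → Bool
  P a b = bit (binom a b)

  P-pascal : ∀ a b → P (a + 1ℤ) (b + 1ℤ) ≡ P a b xor P a (b + 1ℤ)
  P-pascal a b = begin
    bit (binom (a + 1ℤ) (b + 1ℤ))                            ≡⟨ cong bit (binom-pascal (a + 1ℤ) (b + 1ℤ)) ⟩
    bit (binom (a + 1ℤ - 1ℤ) (b + 1ℤ - 1ℤ) + binom (a + 1ℤ - 1ℤ) (b + 1ℤ))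
      ≡⟨ cong bit (cong₂ (λ x y → binom x y + binom x (b + 1ℤ)) (x+1-1≡x a) (x+1-1≡x b)) ⟩
    bit (binom a b + binom a (b + 1ℤ))                       ≡⟨ bit-+ (binom a b) _ ⟩
    bit (binom a b) xor bit (binom a (b + 1ℤ))               ∎
    where open ≡-Reasoning

  P-below : ∀ a x y → x < y → P a (+ x - + y) ≡ false
  P-below a x (suc y) (s≤s x≤y) = cong (λ z → bit (binom a z)) (begin
    + x - + suc y          ≡⟨ ℤ.m-n≡m⊖n x (suc y) ⟩
    x ⊖ suc y              ≡⟨ ℤ.⊖-≤ (ℕ.m≤n⇒m≤1+n x≤y) ⟩
    - + (suc y ∸ x)        ≡⟨ cong (λ d → - + d) (ℕ.+-∸-assoc 1 x≤y) ⟩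
    -[1+ y ∸ x ]           ∎)
    where open ≡-Reasoning

  P-diag : ∀ a x → P a (+ x - + x) ≡ true
  P-diag a x = trans (cong (λ z → bit (binom a z)) (ℤ.+-inverseʳ (+ x))) (cong bit (binomℕ-0 a))

  B≡P : ∀ k l c → B k l c ≡ P (l + + c - 1ℤ) (+ k)
  B≡P k l c = refl

  bit-sum₃ : ∀ a b c d e f →
    bit ((binom a b + binom c d) + binom e f) ≡ (P a b xor P c d) xor P e f
  bit-sum₃ a b c d e f =
    trans (bit-+ (binom a b + binom c d) _) (cong (_xor P e f) (bit-+ (binom a b) _))

P-pascal-up : ∀ a b → P a b ≡ P a (b + 1ℤ) xor P (a + 1ℤ) (b + 1ℤ)
P-pascal-up a b = xor-isolateˡ (P a b) _ _ (P-pascal a b)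

P-pascal-right : ∀ a b → P a (b + 1ℤ) ≡ P (a + 1ℤ) (b + 1ℤ) xor P a b
P-pascal-right a b = xor-isolateʳ (P a b) _ _ (P-pascal a b)

P-nonpos : ∀ a a' x y → x ≤ y → P a (+ x - + y) ≡ P a' (+ x - + y)
P-nonpos a a' x y x≤y with ℕ.m≤n⇒m<n∨m≡n x≤y
... | inj₁ x<y = trans (P-below a x y x<y) (sym (P-below a' x y x<y))
... | inj₂ refl = trans (P-diag a x) (sym (P-diag a' x))

∇B-entry : ∀ k l r c → 1 ≤ r → r ≤ c →
  nabla (B k l) r c ≡ P (l + + c - + r) (+ k + 1ℤ - + r)
∇B-entry k l (suc zero) c _ _ = trans (B≡P k l c) (cong (P (l + + c - 1ℤ)) (sym (x+1-1≡x (+ k))))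
∇B-entry k l (suc (suc r)) (suc c) _ (s≤s r<c) = begin
  nabla (B k l) (suc r) c xor nabla (B k l) (suc r) (suc c)
    ≡⟨ cong₂ _xor_ (∇B-entry k l (suc r) c (s≤s z≤n) r<c)
                   (∇B-entry k l (suc r) (suc c) (s≤s z≤n) (ℕ.m≤n⇒m≤1+n r<c)) ⟩
  P A (+ k + 1ℤ - + suc r) xor P (l + + suc c - + suc r) (+ k + 1ℤ - + suc r)
    ≡⟨ sym (cong₂ (λ x y → P A x xor P y x) (shift-lower (+ k + 1ℤ) (+ suc r)) (shift-upper l (+ c) (+ suc r))) ⟩
  P A (K + 1ℤ) xor P (A + 1ℤ) (K + 1ℤ)
    ≡⟨ sym (P-pascal-up A K) ⟩
  P A K
    ≡⟨ cong (λ x → P x K) (sym (shift-both l (+ c) (+ suc r))) ⟩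
  P (l + + suc c - + suc (suc r)) K ∎
  where
  open ≡-Reasoning
  A : ℤ
  A = l + + c - + suc r
  K : ℤ
  K = + k + 1ℤ - + suc (suc r)
  shift-lower : ∀ x y → x - (1ℤ + y) + 1ℤ ≡ x - y
  shift-lower = solve-∀
  shift-upper : ∀ x y z → x + y - z + 1ℤ ≡ x + (1ℤ + y) - z
  shift-upper = solve-∀
  shift-both : ∀ x y z → x + (1ℤ + y) - (1ℤ + z) ≡ x + y - z
  shift-both = solve-∀

r∇B-entry : ∀ N k l i j → i ≤ j → j ≤ N →
  rotS N (nabla (B k l)) i j ≡ P (l + + N - + j) (+ k + + i - + j)
r∇B-entry N k l i j i≤j j≤N = begin
  nabla (B k l) (suc (j ∸ i)) (suc (N ∸ i))
    ≡⟨ ∇B-entry k l _ _ (s≤s z≤n) (s≤s (ℕ.∸-monoˡ-≤ i j≤N)) ⟩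
  P (l + + suc (N ∸ i) - + suc (j ∸ i)) (+ k + 1ℤ - + suc (j ∸ i))
    ≡⟨ cong₂ (λ u v → P (l + (1ℤ + u) - (1ℤ + v)) (+ k + 1ℤ - (1ℤ + v)))
             (+-∸ (ℕ.≤-trans i≤j j≤N)) (+-∸ i≤j) ⟩
  P (l + (1ℤ + (+ N - + i)) - (1ℤ + (+ j - + i))) (+ k + 1ℤ - (1ℤ + (+ j - + i)))
    ≡⟨ cong₂ P (upper l (+ N) (+ i) (+ j)) (lower (+ k) (+ i) (+ j)) ⟩
  P (l + + N - + j) (+ k + + i - + j) ∎
  where
  open ≡-Reasoning
  upper : ∀ l N i j → l + (1ℤ + (N - i)) - (1ℤ + (j - i)) ≡ l + N - j
  upper = solve-∀
  lower : ∀ k i j → k + 1ℤ - (1ℤ + (j - i)) ≡ k + i - j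
  lower = solve-∀

r²∇B-entry : ∀ N k l i j → 1 ≤ i → i ≤ j → j ≤ N →
  rotS N (rotS N (nabla (B k l))) i j ≡ P (l + + i - 1ℤ) (+ k + + j - + N)
r²∇B-entry N k l i j 1≤i i≤j j≤N = begin
  rotS N (nabla (B k l)) (suc (j ∸ i)) (suc (N ∸ i))
    ≡⟨ r∇B-entry N k l _ _ (s≤s (ℕ.∸-monoˡ-≤ i j≤N)) (ℕ.∸-monoʳ-< 1≤i i≤N) ⟩
  P (l + + N - + suc (N ∸ i)) (+ k + + suc (j ∸ i) - + suc (N ∸ i))
    ≡⟨ cong₂ (λ u v → P (l + + N - (1ℤ + u)) (+ k + (1ℤ + v) - (1ℤ + u))) (+-∸ i≤N) (+-∸ i≤j) ⟩
  P (l + + N - (1ℤ + (+ N - + i))) (+ k + (1ℤ + (+ j - + i)) - (1ℤ + (+ N - + i)))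
    ≡⟨ cong₂ P (upper l (+ N) (+ i)) (lower (+ k) (+ N) (+ i) (+ j)) ⟩
  P (l + + i - 1ℤ) (+ k + + j - + N) ∎
  where
  open ≡-Reasoning
  i≤N : i ≤ N
  i≤N = ℕ.≤-trans i≤j j≤N
  upper : ∀ l N i → l + N - (1ℤ + (N - i)) ≡ l + i - 1ℤ
  upper = solve-∀
  lower : ∀ k N i j → k + (1ℤ + (j - i)) - (1ℤ + (N - i)) ≡ k + j - N
  lower = solve-∀

term₁ term₂ term₃ closedForm : ℕ → ℕ → ℤ → ℕ → ℕ → Bool
term₁ n k l i j = P (l + + j - + i + + n - 1ℤ) (+ suc k - + i)
term₂ n k l i j = P (l + + n - + j) (+ k + + i - + j - + n + 1ℤ)
term₃ n k l i j = P (l + + i - 1ℤ) (+ k + + j - + n)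
closedForm n k l i j = (term₁ n k l i j xor term₂ n k l i j) xor term₃ n k l i j

-- The closed form for γρ(∇B^k_{2n-1,l}):  ρ = r² + r + id contributes one
-- summand per power of r, read off at (i, n-1+j) from the three entry formulas.
γρ∇B-entry : ∀ n k l → 1 ≤ n → gamma n (rho (2 ℕ.* n ∸ 1) (nabla (B k l))) ≈[ n ] closedForm n k l
γρ∇B-entry (suc n₀) k l _ i j 1≤j j≤i i≤n = begin
  (rotS N (rotS N ∇B) i j' xor rotS N ∇B i j') xor ∇B i j'
    ≡⟨ cong₂ _xor_ (cong₂ _xor_ (r²∇B-entry N k l i j' 1≤i i≤j' j'≤N) (r∇B-entry N k l i j' i≤j' j'≤N))
                   (∇B-entry k l i j' 1≤i i≤j') ⟩
  (P (l + + i - 1ℤ) (+ k + + j' - + N) xor P (l + + N - + j') (+ k + + i - + j'))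
    xor P (l + + j' - + i) (+ k + 1ℤ - + i)
    ≡⟨ cong₂ (λ u v → (P (l + + i - 1ℤ) (+ k + u - v) xor P (l + v - u) (+ k + + i - u))
                        xor P (l + u - + i) (+ k + 1ℤ - + i))
             (ℤ.pos-+ n₀ j) +N ⟩
  (P (l + + i - 1ℤ) (+ k + (+ n₀ + + j) - (+ n₀ + (1ℤ + + n₀)))
    xor P (l + (+ n₀ + (1ℤ + + n₀)) - (+ n₀ + + j)) (+ k + + i - (+ n₀ + + j)))
    xor P (l + (+ n₀ + + j) - + i) (+ k + 1ℤ - + i)
    ≡⟨ cong₂ _xor_ (cong₂ _xor_ (cong (P (l + + i - 1ℤ)) (lower₃ (+ k) (+ n₀) (+ j)))
                                (cong₂ P (upper₂ l (+ n₀) (+ j)) (lower₂ (+ k) (+ n₀) (+ i) (+ j))))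
                   (cong₂ P (upper₁ l (+ n₀) (+ i) (+ j)) (lower₁ (+ k) (+ i))) ⟩
  (term₃ n k l i j xor term₂ n k l i j) xor term₁ n k l i j
    ≡⟨ xy∙z≈zy∙x (term₃ n k l i j) _ _ ⟩
  closedForm n k l i j ∎
  where
  open ≡-Reasoning
  n : ℕ
  n = suc n₀
  N : ℕ
  N = 2 ℕ.* n ∸ 1
  j' : ℕ
  j' = n₀ ℕ.+ j
  ∇B : Tri
  ∇B = nabla (B k l)
  1≤i : 1 ≤ i
  1≤i = ℕ.≤-trans 1≤j j≤i
  i≤j' : i ≤ j'
  i≤j' = ℕ.≤-trans i≤n (ℕ.≤-trans (ℕ.≤-reflexive (ℕ.+-comm 1 n₀)) (ℕ.+-monoʳ-≤ n₀ 1≤j))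
  j'≤N : j' ≤ N
  j'≤N = ℕ.+-monoʳ-≤ n₀ (ℕ.≤-trans (ℕ.≤-trans j≤i i≤n) (ℕ.m≤m+n n 0))
  +N : + N ≡ + n₀ + (1ℤ + + n₀)
  +N = trans (ℤ.pos-+ n₀ (n ℕ.+ 0)) (cong (λ m → + n₀ + + m) (ℕ.+-identityʳ n))
  lower₃ : ∀ k n₀ j → k + (n₀ + j) - (n₀ + (1ℤ + n₀)) ≡ k + j - (1ℤ + n₀)
  lower₃ = solve-∀
  upper₂ : ∀ l n₀ j → l + (n₀ + (1ℤ + n₀)) - (n₀ + j) ≡ l + (1ℤ + n₀) - j
  upper₂ = solve-∀
  lower₂ : ∀ k n₀ i j → k + i - (n₀ + j) ≡ k + i - j - (1ℤ + n₀) + 1ℤ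
  lower₂ = solve-∀
  upper₁ : ∀ l n₀ i j → l + (n₀ + j) - i ≡ l + j - i + (1ℤ + n₀) - 1ℤ
  upper₁ = solve-∀
  lower₁ : ∀ k i → k + 1ℤ - i ≡ (1ℤ + k) - i
  lower₁ = solve-∀

term₁-pascal : ∀ n k l i j → term₁ n k l (suc i) (suc j) ≡ term₁ n k l i j xor term₁ n k l i (suc j)
term₁-pascal n k l i j = begin
  P (l + + suc j - + suc i + + n - 1ℤ) K         ≡⟨ cong (λ x → P x K) (upper-at-next l (+ j) (+ i) (+ n)) ⟩
  P A K                                          ≡⟨ P-pascal-up A K ⟩
  P A (K + 1ℤ) xor P (A + 1ℤ) (K + 1ℤ)
    ≡⟨ cong₂ (λ x y → P A x xor P y x) (lower-at-ij (+ suc k) (+ i)) (upper-right l (+ j) (+ i) (+ n)) ⟩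
  term₁ n k l i j xor term₁ n k l i (suc j)      ∎
  where
  open ≡-Reasoning
  A : ℤ
  A = l + + j - + i + + n - 1ℤ
  K : ℤ
  K = + suc k - + suc i
  upper-at-next : ∀ l j i n → l + (1ℤ + j) - (1ℤ + i) + n - 1ℤ ≡ l + j - i + n - 1ℤ
  upper-at-next = solve-∀
  lower-at-ij : ∀ k i → k - (1ℤ + i) + 1ℤ ≡ k - i
  lower-at-ij = solve-∀
  upper-right : ∀ l j i n → l + j - i + n - 1ℤ + 1ℤ ≡ l + (1ℤ + j) - i + n - 1ℤ
  upper-right = solve-∀

term₂-pascal : ∀ n k l i j → term₂ n k l (suc i) (suc j) ≡ term₂ n k l i j xor term₂ n k l i (suc j)
term₂-pascal n k l i j = begin
  P A (+ k + + suc i - + suc j - + n + 1ℤ)       ≡⟨ cong (P A) (sym (lower-at-next (+ k) (+ i) (+ j) (+ n))) ⟩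
  P A (K + 1ℤ)                                   ≡⟨ P-pascal-right A K ⟩
  P (A + 1ℤ) (K + 1ℤ) xor P A K
    ≡⟨ cong₂ (λ x y → P x y xor P A K) (upper-at-ij l (+ j) (+ n)) (lower-at-ij (+ k) (+ i) (+ j) (+ n)) ⟩
  term₂ n k l i j xor term₂ n k l i (suc j)      ∎
  where
  open ≡-Reasoning
  A : ℤ
  A = l + + n - + suc j
  K : ℤ
  K = + k + + i - + suc j - + n + 1ℤ
  upper-at-ij : ∀ l j n → l + n - (1ℤ + j) + 1ℤ ≡ l + n - j
  upper-at-ij = solve-∀
  lower-at-next : ∀ k i j n → k + i - (1ℤ + j) - n + 1ℤ + 1ℤ ≡ k + (1ℤ + i) - (1ℤ + j) - n + 1ℤ
  lower-at-next = solve-∀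
  lower-at-ij : ∀ k i j n → k + i - (1ℤ + j) - n + 1ℤ + 1ℤ ≡ k + i - j - n + 1ℤ
  lower-at-ij = solve-∀

term₃-pascal : ∀ n k l i j → term₃ n k l (suc i) (suc j) ≡ term₃ n k l i j xor term₃ n k l i (suc j)
term₃-pascal n k l i j = begin
  P (l + + suc i - 1ℤ) (+ k + + suc j - + n)
    ≡⟨ sym (cong₂ P (upper-next l (+ i)) (lower-next (+ k) (+ j) (+ n))) ⟩
  P (A + 1ℤ) (K + 1ℤ)                            ≡⟨ P-pascal A K ⟩
  P A K xor P A (K + 1ℤ)                         ≡⟨ cong (λ x → P A K xor P A x) (lower-next (+ k) (+ j) (+ n)) ⟩
  term₃ n k l i j xor term₃ n k l i (suc j)      ∎
  where
  open ≡-Reasoning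
  A : ℤ
  A = l + + i - 1ℤ
  K : ℤ
  K = + k + + j - + n
  upper-next : ∀ l i → l + i - 1ℤ + 1ℤ ≡ l + (1ℤ + i) - 1ℤ
  upper-next = solve-∀
  lower-next : ∀ k j n → k + j - n + 1ℤ ≡ k + (1ℤ + j) - n
  lower-next = solve-∀

closedForm-pascal : ∀ n k l i j →
  closedForm n k l (suc i) (suc j) ≡ closedForm n k l i j xor closedForm n k l i (suc j)
closedForm-pascal n k l i j = begin
  (t₁ (suc i) (suc j) xor t₂ (suc i) (suc j)) xor t₃ (suc i) (suc j)
    ≡⟨ cong₂ _xor_ (cong₂ _xor_ (term₁-pascal n k l i j) (term₂-pascal n k l i j)) (term₃-pascal n k l i j) ⟩
  ((t₁ i j xor t₁ i (suc j)) xor (t₂ i j xor t₂ i (suc j))) xor (t₃ i j xor t₃ i (suc j))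
    ≡⟨ cong (_xor (t₃ i j xor t₃ i (suc j))) (interchange (t₁ i j) _ _ _) ⟩
  ((t₁ i j xor t₂ i j) xor (t₁ i (suc j) xor t₂ i (suc j))) xor (t₃ i j xor t₃ i (suc j))
    ≡⟨ interchange (t₁ i j xor t₂ i j) _ _ _ ⟩
  closedForm n k l i j xor closedForm n k l i (suc j) ∎
  where
  open ≡-Reasoning
  t₁ t₂ t₃ : ℕ → ℕ → Bool
  t₁ = term₁ n k l
  t₂ = term₂ n k l
  t₃ = term₃ n k l

-- The rotation r' permutes the three summands cyclically, so the closed
-- form is invariant under r'.
closedForm-rot : ∀ n k l i j → i ≤ n →
  closedForm n k l ((n ℕ.+ j) ∸ i) (suc n ∸ i) ≡ closedForm n k l i j
closedForm-rot n k l i j i≤n = begin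
  (term₁ n k l i' j' xor term₂ n k l i' j') xor term₃ n k l i' j'
    ≡⟨ cong₂ _xor_ (cong₂ _xor_ t₁≡t₂ t₂≡t₃) t₃≡t₁ ⟩
  (term₂ n k l i j xor term₃ n k l i j) xor term₁ n k l i j
    ≡⟨ xy∙z≈zx∙y (term₂ n k l i j) _ _ ⟩
  closedForm n k l i j ∎
  where
  open ≡-Reasoning
  i' : ℕ
  i' = (n ℕ.+ j) ∸ i
  j' : ℕ
  j' = suc n ∸ i
  +i' : + i' ≡ + n + + j - + i
  +i' = +-∸ (ℕ.≤-trans i≤n (ℕ.m≤m+n n j))
  +j' : + j' ≡ 1ℤ + + n - + i
  +j' = +-∸ (ℕ.m≤n⇒m≤1+n i≤n)
  t₁≡t₂ : term₁ n k l i' j' ≡ term₂ n k l i j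
  t₁≡t₂ = cong₂ P (trans (cong₂ (λ x y → l + y - x + + n - 1ℤ) +i' +j') (upper₁ l (+ n) (+ j) (+ i)))
                  (trans (cong (λ x → (1ℤ + + k) - x) +i') (lower₁ (+ k) (+ n) (+ j) (+ i)))
    where
    upper₁ : ∀ l n j i → l + (1ℤ + n - i) - (n + j - i) + n - 1ℤ ≡ l + n - j
    upper₁ = solve-∀
    lower₁ : ∀ k n j i → (1ℤ + k) - (n + j - i) ≡ k + i - j - n + 1ℤ
    lower₁ = solve-∀
  t₂≡t₃ : term₂ n k l i' j' ≡ term₃ n k l i j
  t₂≡t₃ = cong₂ P (trans (cong (λ y → l + + n - y) +j') (upper₂ l (+ n) (+ i)))
                  (trans (cong₂ (λ x y → + k + x - y - + n + 1ℤ) +i' +j') (lower₂ (+ k) (+ n) (+ j) (+ i)))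
    where
    upper₂ : ∀ l n i → l + n - (1ℤ + n - i) ≡ l + i - 1ℤ
    upper₂ = solve-∀
    lower₂ : ∀ k n j i → k + (n + j - i) - (1ℤ + n - i) - n + 1ℤ ≡ k + j - n
    lower₂ = solve-∀
  t₃≡t₁ : term₃ n k l i' j' ≡ term₁ n k l i j
  t₃≡t₁ = cong₂ P (trans (cong (λ x → l + x - 1ℤ) +i') (upper₃ l (+ n) (+ j) (+ i)))
                  (trans (cong (λ y → + k + y - + n) +j') (lower₃ (+ k) (+ n) (+ i)))
    where
    upper₃ : ∀ l n j i → l + (n + j - i) - 1ℤ ≡ l + j - i + n - 1ℤ
    upper₃ = solve-∀
    lower₃ : ∀ k n i → k + (1ℤ + n - i) - n ≡ (1ℤ + k) - i
    lower₃ = solve-∀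

rotP-index : ∀ {n i j} → 1 ≤ j → j ≤ i → i ≤ n →
  1 ≤ suc n ∸ i × suc n ∸ i ≤ (n ℕ.+ j) ∸ i × (n ℕ.+ j) ∸ i ≤ n
rotP-index {n} {i} {j} 1≤j j≤i i≤n =
  subst (1 ≤_) (sym (ℕ.+-∸-assoc 1 i≤n)) (s≤s z≤n) ,
  ℕ.∸-monoˡ-≤ i (subst (_≤ n ℕ.+ j) (ℕ.+-comm n 1) (ℕ.+-monoʳ-≤ n 1≤j)) ,
  subst ((n ℕ.+ j) ∸ i ≤_) (ℕ.m+n∸n≡m n i) (ℕ.∸-monoˡ-≤ i (ℕ.+-monoʳ-≤ n j≤i))

RPT-resp : ∀ n {a b} → a ≈[ n ] b → IsRPT n b → IsRPT n a
RPT-resp n {a} {b} a≈b (pascal , rot) = pascal′ , rot′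
  where
  pascal′ : IsPT n a
  pascal′ (suc i) (suc j) (s≤s 1≤j) (s≤s j<i) i<n = begin
    a (suc i) (suc j)          ≡⟨ a≈b (suc i) (suc j) (s≤s z≤n) (ℕ.m≤n⇒m≤1+n j<i) i<n ⟩
    b (suc i) (suc j)          ≡⟨ pascal (suc i) (suc j) (s≤s 1≤j) (s≤s j<i) i<n ⟩
    b i j xor b i (suc j)      ≡⟨ sym (cong₂ _xor_ (a≈b i j 1≤j (ℕ.<⇒≤ j<i) i≤n) (a≈b i (suc j) (s≤s z≤n) j<i i≤n)) ⟩
    a i j xor a i (suc j)      ∎
    where
    open ≡-Reasoning
    i≤n : i ≤ n
    i≤n = ℕ.≤-trans (ℕ.n≤1+n i) i<n
  rot′ : rotP n a ≈[ n ] a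
  rot′ i j 1≤j j≤i i≤n with rotP-index 1≤j j≤i i≤n
  ... | 1≤j' , j'≤i' , i'≤n =
    trans (a≈b _ _ 1≤j' j'≤i' i'≤n) (trans (rot i j 1≤j j≤i i≤n) (sym (a≈b i j 1≤j j≤i i≤n)))

closedForm-RPT : ∀ n k l → IsRPT n (closedForm n k l)
closedForm-RPT n k l =
  (λ { (suc i) (suc j) _ _ _ → closedForm-pascal n k l i j }) ,
  (λ i j _ _ i≤n → closedForm-rot n k l i j i≤n)

RPT-xor : ∀ n {a b} → IsRPT n a → IsRPT n b → IsRPT n (λ i j → a i j xor b i j)
RPT-xor n {a} {b} (pa , ra) (pb , rb) =
  (λ i j 2≤j j<i i≤n → trans (cong₂ _xor_ (pa i j 2≤j j<i i≤n) (pb i j 2≤j j<i i≤n))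
                             (interchange (a (i ∸ 1) (j ∸ 1)) _ _ _)) ,
  (λ i j 1≤j j≤i i≤n → cong₂ _xor_ (ra i j 1≤j j≤i i≤n) (rb i j 1≤j j≤i i≤n))

RPT-scale : ∀ n c {a} → IsRPT n a → IsRPT n (λ i j → c ∧ a i j)
RPT-scale n true ra = ra
RPT-scale n false ra = (λ _ _ _ _ _ → refl) , (λ _ _ _ _ _ → refl)

RPT-lincomb : ∀ n {m} (c : Fin m → Bool) (v : Fin m → Tri) →
  (∀ k → IsRPT n (v k)) → IsRPT n (lincomb c v)
RPT-lincomb n {zero} c v _ = (λ _ _ _ _ _ → refl) , (λ _ _ _ _ _ → refl)
RPT-lincomb n {suc m} c v rpt =
  RPT-xor n (RPT-scale n (c fzero) (rpt fzero)) (RPT-lincomb n (c ∘ fsuc) (v ∘ fsuc) (rpt ∘ fsuc))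

VanishesAtPivots : ℕ → Tri → Set
VanishesAtPivots n Δ = ∀ s → s < mOf n → Δ (suc s) (suc ⌊ s /2⌋) ≡ false

mOf-step : ∀ k → mOf (3 ℕ.+ suc k) ≡ 2 ℕ.+ mOf (suc k)
mOf-step k = trans (cong (λ q → 2 ℕ.* q ℕ.+ 1) (m/n≡1+[m∸n]/n {3 ℕ.+ k} {3} (s≤s (s≤s (s≤s z≤n)))))
  (cong (λ x → suc x ℕ.+ 1) (ℕ.+-suc (k / 3) (k / 3 ℕ.+ 0)))

-- The interior of a triangle of size n: the entries (i+2, j+1) with
-- 1 ≤ j ≤ i ≤ n-3, i.e. everything off the first column, the last row and
-- the diagonal, viewed as a triangle of size n-3.
inner : Tri → Tri
inner Δ i j = Δ (suc (suc i)) (suc j)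

inner-RPT : ∀ n {Δ} → IsRPT (3 ℕ.+ n) Δ → IsRPT n (inner Δ)
inner-RPT n {Δ} (pascal , rot) = pascal′ , rot′
  where
  pascal′ : IsPT n (inner Δ)
  pascal′ (suc i) (suc j) (s≤s 1≤j) (s≤s j<i) (s≤s i≤n) =
    pascal (3 ℕ.+ i) (2 ℕ.+ j) (s≤s (s≤s z≤n)) (s≤s (s≤s (s≤s (ℕ.<⇒≤ j<i)))) (s≤s (s≤s (s≤s (ℕ.m≤n⇒m≤1+n i≤n))))
  rot′ : rotP n (inner Δ) ≈[ n ] inner Δ
  rot′ i j 1≤j j≤i i≤n = trans (cong₂ Δ row col)
    (rot (2 ℕ.+ i) (suc j) (s≤s z≤n) (s≤s (ℕ.m≤n⇒m≤1+n j≤i)) (s≤s (s≤s (ℕ.m≤n⇒m≤1+n i≤n))))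
    where
    row : 2 ℕ.+ ((n ℕ.+ j) ∸ i) ≡ (3 ℕ.+ n ℕ.+ suc j) ∸ (2 ℕ.+ i)
    row = trans (sym (ℕ.+-∸-assoc 2 (ℕ.≤-trans i≤n (ℕ.m≤m+n n j))))
                (cong (λ x → suc x ∸ i) (sym (ℕ.+-suc n j)))
    col : suc (suc n ∸ i) ≡ suc (3 ℕ.+ n) ∸ (2 ℕ.+ i)
    col = sym (ℕ.+-∸-assoc 1 (ℕ.m≤n⇒m≤1+n i≤n))

inner-pivots : ∀ k {Δ} → VanishesAtPivots (3 ℕ.+ suc k) Δ → VanishesAtPivots (suc k) (inner Δ)
inner-pivots k piv s s<m = piv (2 ℕ.+ s) (subst (2 ℕ.+ s <_) (sym (mOf-step k)) (s≤s (s≤s s<m)))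

module Boundary {N : ℕ} {Δ : Tri} (rot : rotP N Δ ≈[ N ] Δ) where

  last-row : ∀ j → 1 ≤ j → j ≤ N → Δ N j ≡ Δ j 1
  last-row j 1≤j j≤N =
    trans (sym (rot N j 1≤j j≤N ℕ.≤-refl)) (cong₂ Δ (ℕ.m+n∸m≡n N j) (ℕ.m+n∸n≡m 1 N))

  diagonal : ∀ i → 1 ≤ i → i ≤ N → Δ i i ≡ Δ N (suc N ∸ i)
  diagonal i 1≤i i≤N =
    trans (sym (rot i i 1≤i ℕ.≤-refl i≤N)) (cong (λ x → Δ x (suc N ∸ i)) (ℕ.m+n∸n≡m N i))

  vanish-from-column : (∀ i → 1 ≤ i → i ≤ N → Δ i 1 ≡ false) →
    inner Δ ≈[ N ∸ 3 ] zeroTri → Δ ≈[ N ] zeroTri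
  vanish-from-column column interior i (suc zero) _ j≤i i≤N = column i j≤i i≤N
  vanish-from-column column interior i j@(suc (suc j')) 1≤j j≤i i≤N with i ℕ.≟ N | j ℕ.≟ i
  ... | yes refl | _ = trans (last-row j 1≤j j≤i) (column j 1≤j j≤i)
  ... | no _ | yes refl =
    trans (diagonal i 1≤j i≤N) (trans (last-row (suc N ∸ i) 1≤i' i'≤N) (column (suc N ∸ i) 1≤i' i'≤N))
    where
    1≤i' : 1 ≤ suc N ∸ i
    1≤i' = proj₁ (rotP-index 1≤j ℕ.≤-refl i≤N)
    i'≤N : suc N ∸ i ≤ N
    i'≤N = ℕ.∸-monoʳ-≤ (suc N) 1≤j
  ... | no i≢N | no j≢i with ℕ.≤∧≢⇒< j≤i j≢i | ℕ.≤∧≢⇒< i≤N i≢N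
  ... | s≤s (s≤s {n = i₀} j'<i₀) | i<N =
    interior i₀ (suc j') (s≤s z≤n) j'<i₀ (ℕ.m+n≤o⇒m≤o∸n i₀ (subst (_≤ N) (ℕ.+-comm 3 i₀) i<N))

≈[0] : ∀ a b → a ≈[ 0 ] b
≈[0] a b i (suc j) 1≤j (s≤s j≤i) ()

0<mOf : ∀ n → 0 < mOf n
0<mOf n = ℕ.m≤n+m 1 (2 ℕ.* ((n ∸ 1) / 3))

1<mOf : ∀ k → 1 < mOf (3 ℕ.+ suc k)
1<mOf k = subst (1 <_) (sym (mOf-step k)) (s≤s (s≤s z≤n))

xor-zero : ∀ {x y z} → z ≡ x xor y → z ≡ false → y ≡ false → x ≡ false
xor-zero {x} {y} {z} z≡x+y refl refl = xor-isolateˡ x y z z≡x+y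

-- The Pascal
-- rule along the second column and the pivots (1,1), (2,1) kill the first
-- column, and rotation does the rest.
vanish-step : ∀ k {Δ} → IsRPT (3 ℕ.+ suc k) Δ → VanishesAtPivots (3 ℕ.+ suc k) Δ →
  inner Δ ≈[ suc k ] zeroTri → Δ ≈[ 3 ℕ.+ suc k ] zeroTri
vanish-step k {Δ} (pascal , rot) piv interior = vanish-from-column column interior
  where
  open Boundary rot
  N : ℕ
  N = 3 ℕ.+ suc k
  -- Below the diagonal the second column lies in the interior, except for
  -- its last entry, which rotation identifies with the pivot (2,1).
  second : ∀ i → 3 ≤ i → i ≤ N → Δ i 2 ≡ false
  second i 3≤i i≤N with i ℕ.≟ N
  ... | yes refl = trans (last-row 2 (s≤s z≤n) (ℕ.≤-trans (s≤s (s≤s z≤n)) 3≤i)) (piv 1 (1<mOf k))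
  ... | no i≢N with 3≤i | ℕ.≤∧≢⇒< i≤N i≢N
  ...   | s≤s (s≤s (s≤s {n = i₀} _)) | s≤s (s≤s (s≤s i₀<k+1)) =
    interior (suc i₀) 1 (s≤s z≤n) (s≤s z≤n) i₀<k+1
  -- The first column: two pivots on top, then Δ(i+1,2) = Δ(i,1) + Δ(i,2),
  -- and Δ(N,1) = Δ(1,1) by rotation.
  column : ∀ i → 1 ≤ i → i ≤ N → Δ i 1 ≡ false
  column (suc zero) _ _ = piv 0 (0<mOf N)
  column (suc (suc zero)) _ _ = piv 1 (1<mOf k)
  column i@(suc (suc (suc i₀))) _ i≤N with i ℕ.≟ N
  ... | yes refl = trans (last-row 1 (s≤s z≤n) (s≤s z≤n)) (piv 0 (0<mOf N))
  ... | no i≢N = xor-zero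
    (pascal (suc i) 2 ℕ.≤-refl (s≤s (s≤s (s≤s z≤n))) i<N)
    (second (suc i) (s≤s (s≤s (s≤s z≤n))) i<N)
    (second i (s≤s (s≤s (s≤s z≤n))) i≤N)
    where
    i<N : i < N
    i<N = ℕ.≤∧≢⇒< i≤N i≢N

-- The interior of a triangle of size k+4 is an
-- RPT triangle of size k+1 vanishing at its pivots, so it vanishes by
-- induction; sizes up to 3 are checked directly.
pivots-unique : ∀ n Δ → IsRPT n Δ → VanishesAtPivots n Δ → Δ ≈[ n ] zeroTri
pivots-unique zero Δ _ _ = ≈[0] Δ zeroTri
pivots-unique (suc zero) Δ (_ , rot) piv = vanish-from-column column (≈[0] _ _)
  where
  open Boundary rot
  column : ∀ i → 1 ≤ i → i ≤ 1 → Δ i 1 ≡ false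
  column (suc zero) _ _ = piv 0 (0<mOf 1)
  column (suc (suc _)) _ (s≤s ())
pivots-unique (suc (suc zero)) Δ (_ , rot) piv = vanish-from-column column (≈[0] _ _)
  where
  open Boundary rot
  column : ∀ i → 1 ≤ i → i ≤ 2 → Δ i 1 ≡ false
  column (suc zero) _ _ = piv 0 (0<mOf 2)
  column (suc (suc zero)) _ _ = trans (last-row 1 (s≤s z≤n) (s≤s z≤n)) (piv 0 (0<mOf 2))
  column (suc (suc (suc _))) _ (s≤s (s≤s ()))
pivots-unique (suc (suc (suc zero))) Δ (pascal , rot) piv = vanish-from-column column (≈[0] _ _)
  where
  open Boundary rot
  -- Δ₃₂ = Δ₂₁ + Δ₂₂, while rotation gives Δ₂₁ = Δ₃₂ = Δ₂₂.
  Δ₃₂≡false : Δ 3 2 ≡ false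
  Δ₃₂≡false = begin
    Δ 3 2                 ≡⟨ pascal 3 2 ℕ.≤-refl ℕ.≤-refl ℕ.≤-refl ⟩
    Δ 2 1 xor Δ 2 2       ≡⟨ cong₂ _xor_ (sym (last-row 2 (s≤s z≤n) (s≤s (s≤s z≤n))))
                                        (diagonal 2 (s≤s z≤n) (s≤s (s≤s z≤n))) ⟩
    Δ 3 2 xor Δ 3 2       ≡⟨ xor-same (Δ 3 2) ⟩
    false                 ∎
    where open ≡-Reasoning
  column : ∀ i → 1 ≤ i → i ≤ 3 → Δ i 1 ≡ false
  column (suc zero) _ _ = piv 0 (0<mOf 3)
  column (suc (suc zero)) _ _ = trans (sym (last-row 2 (s≤s z≤n) (s≤s (s≤s z≤n)))) Δ₃₂≡false
  column (suc (suc (suc zero))) _ _ = trans (last-row 1 (s≤s z≤n) (s≤s z≤n)) (piv 0 (0<mOf 3))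
  column (suc (suc (suc (suc _)))) _ (s≤s (s≤s (s≤s ())))
pivots-unique (suc (suc (suc (suc k)))) Δ rpt piv =
  vanish-step k rpt piv (pivots-unique (suc k) (inner Δ) (inner-RPT (suc k) rpt) (inner-pivots k {Δ} piv))

⌈/2⌉-cases : ∀ s → ⌈ s /2⌉ ≡ ⌊ s /2⌋ ⊎ ⌈ s /2⌉ ≡ suc ⌊ s /2⌋
⌈/2⌉-cases zero = inj₁ refl
⌈/2⌉-cases (suc zero) = inj₂ refl
⌈/2⌉-cases (suc (suc s)) = Sum.map (cong suc) (cong suc) (⌈/2⌉-cases s)

+-cancel-double-≤ : ∀ {a b} → a ℕ.+ a ≤ b ℕ.+ b → a ≤ b
+-cancel-double-≤ a+a≤b+b = ℕ.≮⇒≥ (λ b<a → ℕ.<⇒≱ (ℕ.+-mono-< b<a b<a) a+a≤b+b)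

+-cancel-double-< : ∀ {a b} → a ℕ.+ a < b ℕ.+ b → a < b
+-cancel-double-< a+a<b+b = ℕ.≰⇒> (λ b≤a → ℕ.<⇒≱ a+a<b+b (ℕ.+-mono-≤ b≤a b≤a))

-- Position of the pivots relative to n = n₀+1 when 3T ≤ n₀ and s ≤ 2T (in the
-- theorem T = ⌊n₀/3⌋, m = 2T+1): for k ≤ s, either s is even and
-- k + s/2 + 1 ≤ n, or s is odd and k + ⌈s/2⌉ + 1 < n.
pivot-bound : ∀ T n₀ k s → T ℕ.+ T ℕ.+ T ≤ n₀ → s ≤ T ℕ.+ T → k ≤ s →
  (⌈ s /2⌉ ≡ ⌊ s /2⌋ × suc (k ℕ.+ ⌊ s /2⌋) ≤ suc n₀)
  ⊎ (⌈ s /2⌉ ≡ suc ⌊ s /2⌋ × suc (k ℕ.+ ⌈ s /2⌉) < suc n₀)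
pivot-bound T n₀ k s 3T≤n₀ s≤2T k≤s with ⌈/2⌉-cases s | ℕ.⌊n/2⌋+⌈n/2⌉≡n s
... | inj₁ c≡h | h+c≡s = inj₁ (c≡h , s≤s (begin
  k ℕ.+ h               ≤⟨ ℕ.+-monoˡ-≤ h k≤s ⟩
  s ℕ.+ h               ≡⟨ cong (ℕ._+ h) s≡h+h ⟩
  h ℕ.+ h ℕ.+ h         ≤⟨ ℕ.+-mono-≤ (ℕ.+-mono-≤ h≤T h≤T) h≤T ⟩
  T ℕ.+ T ℕ.+ T         ≤⟨ 3T≤n₀ ⟩
  n₀                    ∎))
  where
  open ℕ.≤-Reasoning
  h : ℕ
  h = ⌊ s /2⌋
  s≡h+h : s ≡ h ℕ.+ h
  s≡h+h = trans (sym h+c≡s) (cong (h ℕ.+_) c≡h)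
  h≤T : h ≤ T
  h≤T = +-cancel-double-≤ (subst (_≤ T ℕ.+ T) s≡h+h s≤2T)
... | inj₂ c≡1+h | h+c≡s = inj₂ (c≡1+h , s≤s (begin
  suc (k ℕ.+ ⌈ s /2⌉)         ≡⟨ cong (λ c → suc (k ℕ.+ c)) c≡1+h ⟩
  suc (k ℕ.+ suc h)           ≤⟨ s≤s (ℕ.+-monoˡ-≤ (suc h) k≤s) ⟩
  suc (s ℕ.+ suc h)           ≡⟨ cong (λ x → suc (x ℕ.+ suc h)) s≡h+1+h ⟩
  suc (h ℕ.+ suc h ℕ.+ suc h) ≡⟨ thrice h ⟩
  suc h ℕ.+ suc h ℕ.+ suc h   ≤⟨ ℕ.+-mono-≤ (ℕ.+-mono-≤ h<T h<T) h<T ⟩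
  T ℕ.+ T ℕ.+ T               ≤⟨ 3T≤n₀ ⟩
  n₀                          ∎))
  where
  open ℕ.≤-Reasoning
  h : ℕ
  h = ⌊ s /2⌋
  s≡h+1+h : s ≡ h ℕ.+ suc h
  s≡h+1+h = trans (sym h+c≡s) (cong (h ℕ.+_) c≡1+h)
  h<T : h < T
  h<T = +-cancel-double-< (subst (_≤ T ℕ.+ T) (trans s≡h+1+h (ℕ.+-suc h h)) s≤2T)
  thrice : ∀ h → suc (h ℕ.+ suc h ℕ.+ suc h) ≡ suc h ℕ.+ suc h ℕ.+ suc h
  thrice = ℕ-solve-∀

pivot-lower₂ : ∀ n k s → + k + + suc s - + suc ⌊ s /2⌋ - + n + 1ℤ ≡ + suc (k ℕ.+ ⌈ s /2⌉) - + n
pivot-lower₂ n k s = begin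
  + k + + suc s - + suc h - + n + 1ℤ
    ≡⟨ cong (λ x → + k + (1ℤ + x) - + suc h - + n + 1ℤ)
            (trans (cong +_ (sym (ℕ.⌊n/2⌋+⌈n/2⌉≡n s))) (ℤ.pos-+ h c)) ⟩
  + k + (1ℤ + (+ h + + c)) - (1ℤ + + h) - + n + 1ℤ
    ≡⟨ cancel (+ k) (+ h) (+ c) (+ n) ⟩
  1ℤ + (+ k + + c) - + n
    ≡⟨ cong (λ x → 1ℤ + x - + n) (sym (ℤ.pos-+ k c)) ⟩
  + suc (k ℕ.+ c) - + n ∎
  where
  open ≡-Reasoning
  h : ℕ
  h = ⌊ s /2⌋
  c : ℕ
  c = ⌈ s /2⌉
  cancel : ∀ k h c n → k + (1ℤ + (h + c)) - (1ℤ + h) - n + 1ℤ ≡ 1ℤ + (k + c) - n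
  cancel = solve-∀

pivot-lower₃ : ∀ n k s → + k + + suc ⌊ s /2⌋ - + n ≡ + suc (k ℕ.+ ⌊ s /2⌋) - + n
pivot-lower₃ n k s = cong (_- + n) (trans (assoc (+ k) (+ ⌊ s /2⌋)) (cong (λ x → 1ℤ + x) (sym (ℤ.pos-+ k ⌊ s /2⌋))))
  where
  assoc : ∀ k h → k + (1ℤ + h) ≡ 1ℤ + (k + h)
  assoc = solve-∀

-- At the s-th pivot and for k ≤ s, the summands of the closed form coming
-- from r and r² cancel: their lower indices are equal and ≤ 0 (s even), or
-- both negative (s odd).
pivot-term₂₃ : ∀ T n₀ k l s → T ℕ.+ T ℕ.+ T ≤ n₀ → s ≤ T ℕ.+ T → k ≤ s →
  term₂ (suc n₀) k l (suc s) (suc ⌊ s /2⌋) xor term₃ (suc n₀) k l (suc s) (suc ⌊ s /2⌋) ≡ false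
pivot-term₂₃ T n₀ k l s 3T≤n₀ s≤2T k≤s
  with pivot-bound T n₀ k s 3T≤n₀ s≤2T k≤s
... | inj₁ (c≡h , bound) = begin
  P a (+ k + + suc s - + suc h - + n + 1ℤ) xor P b (+ k + + suc h - + n)
    ≡⟨ cong₂ _xor_ (cong (P a) (trans (pivot-lower₂ n k s) (cong (λ c → + suc (k ℕ.+ c) - + n) c≡h)))
                   (cong (P b) (pivot-lower₃ n k s)) ⟩
  P a (+ suc (k ℕ.+ h) - + n) xor P b (+ suc (k ℕ.+ h) - + n)
    ≡⟨ cong (_xor P b (+ suc (k ℕ.+ h) - + n)) (P-nonpos a b _ _ bound) ⟩
  P b (+ suc (k ℕ.+ h) - + n) xor P b (+ suc (k ℕ.+ h) - + n)
    ≡⟨ xor-same (P b (+ suc (k ℕ.+ h) - + n)) ⟩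
  false ∎
  where
  open ≡-Reasoning
  n : ℕ
  n = suc n₀
  h : ℕ
  h = ⌊ s /2⌋
  a : ℤ
  a = l + + n - + suc h
  b : ℤ
  b = l + + suc s - 1ℤ
... | inj₂ (c≡1+h , bound) = cong₂ _xor_
  (trans (cong (P a) (pivot-lower₂ n k s)) (P-below a _ _ bound))
  (trans (cong (P b) (pivot-lower₃ n k s)) (P-below b _ _ (ℕ.≤-trans (s≤s (s≤s (ℕ.+-monoʳ-≤ k h≤c))) bound)))
  where
  n : ℕ
  n = suc n₀
  h : ℕ
  h = ⌊ s /2⌋
  a : ℤ
  a = l + + n - + suc h
  b : ℤ
  b = l + + suc s - 1ℤ
  h≤c : h ≤ ⌈ s /2⌉
  h≤c = ℕ.⌊n/2⌋≤⌈n/2⌉ s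

-- Consequently the s-th pivot entry of the k-th closed form is
-- C(·, k-s) mod 2: zero for k < s and one for k = s.
pivot-entry : ∀ T n₀ k l s → T ℕ.+ T ℕ.+ T ≤ n₀ → s ≤ T ℕ.+ T → k ≤ s →
  closedForm (suc n₀) k l (suc s) (suc ⌊ s /2⌋) ≡ term₁ (suc n₀) k l (suc s) (suc ⌊ s /2⌋)
pivot-entry T n₀ k l s 3T≤n₀ s≤2T k≤s =
  trans (xor-assoc (term₁ n k l i j) _ _)
        (trans (cong (term₁ n k l i j xor_) (pivot-term₂₃ T n₀ k l s 3T≤n₀ s≤2T k≤s))
               (xor-identityʳ _))
  where
  n : ℕ
  n = suc n₀
  i : ℕ
  i = suc s
  j : ℕ
  j = suc ⌊ s /2⌋

dot : ∀ {m} → (Fin m → Bool) → (Fin m → Bool) → Bool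
dot {zero} c x = false
dot {suc m} c x = (c fzero ∧ x fzero) xor dot (c ∘ fsuc) (x ∘ fsuc)

lincomb-entry : ∀ {m} (c : Fin m → Bool) (v : Fin m → Tri) i j →
  lincomb c v i j ≡ dot c (λ k → v k i j)
lincomb-entry {zero} c v i j = refl
lincomb-entry {suc m} c v i j = cong ((c fzero ∧ v fzero i j) xor_) (lincomb-entry (c ∘ fsuc) (v ∘ fsuc) i j)

dot-zeroˡ : ∀ {m} (c x : Fin m → Bool) → (∀ k → c k ≡ false) → dot c x ≡ false
dot-zeroˡ {zero} c x c≡0 = refl
dot-zeroˡ {suc m} c x c≡0 rewrite c≡0 fzero = dot-zeroˡ (c ∘ fsuc) (x ∘ fsuc) (c≡0 ∘ fsuc)

dot-headˡ-false : ∀ {m} (c x : Fin (suc m) → Bool) → x fzero ≡ false →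
  dot c x ≡ dot (c ∘ fsuc) (x ∘ fsuc)
dot-headˡ-false c x x₀≡0 rewrite x₀≡0 | ∧-zeroʳ (c fzero) = refl

dot-headˡ-true : ∀ {m} (c x : Fin (suc m) → Bool) → x fzero ≡ true →
  dot c x ≡ c fzero xor dot (c ∘ fsuc) (x ∘ fsuc)
dot-headˡ-true c x x₀≡1 rewrite x₀≡1 | ∧-identityʳ (c fzero) = refl

-- Upper unitriangular matrices over ℤ/2 (M s k is the entry in row s, column k).
record Unitriangular {m} (M : Fin m → Fin m → Bool) : Set where
  field
    below-diagonal : ∀ s k → toℕ k < toℕ s → M s k ≡ false
    on-diagonal : ∀ s → M s s ≡ true

minor : ∀ {m} → (Fin (suc m) → Fin (suc m) → Bool) → Fin m → Fin m → Bool
minor M s k = M (fsuc s) (fsuc k)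

minor-unitriangular : ∀ {m} {M : Fin (suc m) → Fin (suc m) → Bool} →
  Unitriangular M → Unitriangular (minor M)
minor-unitriangular U = record
  { below-diagonal = λ s k k<s → below-diagonal (fsuc s) (fsuc k) (s≤s k<s)
  ; on-diagonal = λ s → on-diagonal (fsuc s) }
  where open Unitriangular U

unitriangular-injective : ∀ {m} {M : Fin m → Fin m → Bool} → Unitriangular M →
  (c : Fin m → Bool) → (∀ s → dot c (M s) ≡ false) → ∀ k → c k ≡ false
unitriangular-injective {suc m} {M} U c Mc≡0 = c≡0
  where
  open Unitriangular U
  -- rows 1, 2, … only see the coefficients c₁, c₂, …
  tail≡0 : ∀ k → c (fsuc k) ≡ false
  tail≡0 = unitriangular-injective (minor-unitriangular U) (c ∘ fsuc) λ s →
    trans (sym (dot-headˡ-false c (M (fsuc s)) (below-diagonal (fsuc s) fzero (s≤s z≤n)))) (Mc≡0 (fsuc s))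
  -- then row 0 reads c₀ = 0
  c≡0 : ∀ k → c k ≡ false
  c≡0 fzero = begin
    c fzero                                      ≡⟨ sym (xor-identityʳ _) ⟩
    c fzero xor false                            ≡⟨ cong (c fzero xor_) (sym (dot-zeroˡ (c ∘ fsuc) (M fzero ∘ fsuc) tail≡0)) ⟩
    c fzero xor dot (c ∘ fsuc) (M fzero ∘ fsuc)  ≡⟨ sym (dot-headˡ-true c (M fzero) (on-diagonal fzero)) ⟩
    dot c (M fzero)                              ≡⟨ Mc≡0 fzero ⟩
    false                                        ∎
    where open ≡-Reasoning
  c≡0 (fsuc k) = tail≡0 k

unitriangular-surjective : ∀ {m} {M : Fin m → Fin m → Bool} → Unitriangular M →
  (t : Fin m → Bool) → Σ (Fin m → Bool) λ c → ∀ s → dot c (M s) ≡ t s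
unitriangular-surjective {zero} U t = (λ ()) , λ ()
unitriangular-surjective {suc m} {M} U t = c₀ ∷ c′ , Mc≡t
  where
  open Unitriangular U
  rest : Σ (Fin m → Bool) λ c → ∀ s → dot c (minor M s) ≡ t (fsuc s)
  rest = unitriangular-surjective (minor-unitriangular U) (t ∘ fsuc)
  c′ : Fin m → Bool
  c′ = proj₁ rest
  c₀ : Bool
  c₀ = t fzero xor dot c′ (M fzero ∘ fsuc)
  Mc≡t : ∀ s → dot (c₀ ∷ c′) (M s) ≡ t s
  Mc≡t fzero = begin
    dot (c₀ ∷ c′) (M fzero)                              ≡⟨ dot-headˡ-true (c₀ ∷ c′) (M fzero) (on-diagonal fzero) ⟩
    (t fzero xor dot c′ (M fzero ∘ fsuc)) xor dot c′ (M fzero ∘ fsuc)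
                                                         ≡⟨ xor-assoc (t fzero) _ _ ⟩
    t fzero xor (dot c′ (M fzero ∘ fsuc) xor dot c′ (M fzero ∘ fsuc))
                                                         ≡⟨ cong (t fzero xor_) (xor-same (dot c′ (M fzero ∘ fsuc))) ⟩
    t fzero xor false                                    ≡⟨ xor-identityʳ _ ⟩
    t fzero                                              ∎
    where open ≡-Reasoning
  Mc≡t (fsuc s) = trans (dot-headˡ-false (c₀ ∷ c′) (M (fsuc s)) (below-diagonal (fsuc s) fzero (s≤s z≤n)))
                        (proj₂ rest s)

xor≡false⇒≡ : ∀ {x y} → x xor y ≡ false → x ≡ y
xor≡false⇒≡ {x} {y} x+y≡0 = trans (xor-isolateˡ x y false (sym x+y≡0)) (xor-identityʳ y)

-- For n = n₀+1 put T = ⌊n₀/3⌋, so that m = 2T+1; then 3T ≤ n₀ and s < m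
-- means s ≤ 2T.
3⌊n₀/3⌋≤n₀ : ∀ n₀ → n₀ / 3 ℕ.+ n₀ / 3 ℕ.+ n₀ / 3 ≤ n₀
3⌊n₀/3⌋≤n₀ n₀ = subst (_≤ n₀) (thrice (n₀ / 3)) (m/n*n≤m n₀ 3)
  where
  thrice : ∀ x → x ℕ.* 3 ≡ x ℕ.+ x ℕ.+ x
  thrice = ℕ-solve-∀

<mOf⇒≤2⌊n₀/3⌋ : ∀ n₀ s → s < mOf (suc n₀) → s ≤ n₀ / 3 ℕ.+ n₀ / 3
<mOf⇒≤2⌊n₀/3⌋ n₀ s s<m = subst (s ≤_) (cong (T ℕ.+_) (ℕ.+-identityʳ T))
  (ℕ.≤-pred (subst (suc s ≤_) (ℕ.+-comm (2 ℕ.* T) 1) s<m))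
  where T = n₀ / 3

module Basis (n₀ : ℕ) (l : Fin (mOf (suc n₀)) → ℤ) where
  n : ℕ
  n = suc n₀
  m : ℕ
  m = mOf n
  T : ℕ
  T = n₀ / 3
  v : Fin m → Tri
  v = fam n l

  v≈closedForm : ∀ k → v k ≈[ n ] closedForm n (toℕ k) (l k)
  v≈closedForm k = γρ∇B-entry n (toℕ k) (l k) (s≤s z≤n)

  v-RPT : ∀ k → IsRPT n (v k)
  v-RPT k = RPT-resp n (v≈closedForm k) (closedForm-RPT n (toℕ k) (l k))

  row col : Fin m → ℕ
  row s = suc (toℕ s)
  col s = suc ⌊ toℕ s /2⌋

  s≤2T : ∀ s → toℕ s ≤ T ℕ.+ T
  s≤2T s = <mOf⇒≤2⌊n₀/3⌋ n₀ (toℕ s) (toℕ<n s)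

  1≤col : ∀ s → 1 ≤ col s
  1≤col s = s≤s z≤n
  col≤row : ∀ s → col s ≤ row s
  col≤row s = s≤s (ℕ.⌊n/2⌋≤n (toℕ s))
  row≤n : ∀ s → row s ≤ n
  row≤n s = s≤s (ℕ.≤-trans (s≤2T s) (ℕ.≤-trans (ℕ.m≤m+n (T ℕ.+ T) T) (3⌊n₀/3⌋≤n₀ n₀)))

  -- The values of the family at the pivots: row s is the s-th pivot,
  -- column k the k-th triangle.
  pivotMatrix : Fin m → Fin m → Bool
  pivotMatrix s k = v k (row s) (col s)

  -- On and below the diagonal only term₁ contributes (pivot-entry).
  pivotMatrix-entry : ∀ s k → toℕ k ≤ toℕ s →
    pivotMatrix s k ≡ P (l k + + col s - + row s + + n - 1ℤ) (+ suc (toℕ k) - + row s)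
  pivotMatrix-entry s k k≤s =
    trans (v≈closedForm k (row s) (col s) (1≤col s) (col≤row s) (row≤n s))
          (pivot-entry T n₀ (toℕ k) (l k) (toℕ s) (3⌊n₀/3⌋≤n₀ n₀) (s≤2T s) k≤s)

  pivotMatrix-unitriangular : Unitriangular pivotMatrix
  pivotMatrix-unitriangular = record
    { below-diagonal = λ s k k<s →
        trans (pivotMatrix-entry s k (ℕ.<⇒≤ k<s)) (P-below _ _ _ (s≤s k<s))
    ; on-diagonal = λ s → trans (pivotMatrix-entry s s ℕ.≤-refl) (P-diag _ (row s)) }

  -- Linear independence: the pivot entries of a vanishing combination form
  -- a homogeneous unitriangular system.
  independent : ∀ c → lincomb c v ≈[ n ] zeroTri → ∀ k → c k ≡ false
  independent c c·v≈0 = unitriangular-injective pivotMatrix-unitriangular c λ s →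
    trans (sym (lincomb-entry c v (row s) (col s))) (c·v≈0 (row s) (col s) (1≤col s) (col≤row s) (row≤n s))

  -- Spanning: choose c matching Δ at the pivots; then c·v + Δ is an RPT
  -- triangle vanishing at the pivots, hence zero.
  spanning : ∀ Δ → IsRPT n Δ → Σ (Fin m → Bool) λ c → lincomb c v ≈[ n ] Δ
  spanning Δ Δ-RPT = c , λ i j 1≤j j≤i i≤n → xor≡false⇒≡ (D≈0 i j 1≤j j≤i i≤n)
    where
    solution : Σ (Fin m → Bool) λ c → ∀ s → dot c (pivotMatrix s) ≡ Δ (row s) (col s)
    solution = unitriangular-surjective pivotMatrix-unitriangular (λ s → Δ (row s) (col s))
    c : Fin m → Bool
    c = proj₁ solution
    D : Tri
    D i j = lincomb c v i j xor Δ i j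
    D-pivots : VanishesAtPivots n D
    D-pivots s s<m = subst (λ t → D (suc t) (suc ⌊ t /2⌋) ≡ false) (toℕ-fromℕ< s<m) (begin
      lincomb c v (row s′) (col s′) xor Δ (row s′) (col s′)
        ≡⟨ cong (_xor Δ (row s′) (col s′)) (trans (lincomb-entry c v (row s′) (col s′)) (proj₂ solution s′)) ⟩
      Δ (row s′) (col s′) xor Δ (row s′) (col s′)
        ≡⟨ xor-same (Δ (row s′) (col s′)) ⟩
      false ∎)
      where
      open ≡-Reasoning
      s′ : Fin m
      s′ = fromℕ< s<m
    D≈0 : D ≈[ n ] zeroTri
    D≈0 = pivots-unique n D (RPT-xor n (RPT-lincomb n c v v-RPT) Δ-RPT) D-pivots

  isBasis : IsBasisRPT n v
  isBasis = v-RPT , independent , spanning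

mainTheorem14 : (n : ℕ) → 1 ≤ n → (l : Fin (mOf n) → ℤ) →
    IsBasisRPT n (fam n l)
    × (∀ (k : Fin (mOf n)) → ∀ i j → 1 ≤ j → j ≤ i → i ≤ n →
    fam n l k i j
    ≡ bit ((binom (l k + + j - + i + + n - 1ℤ) (+ suc (toℕ k) - + i)
    + binom (l k + + n - + j) (+ toℕ k + + i - + j - + n + 1ℤ))
    + binom (l k + + i - 1ℤ) (+ toℕ k + + j - + n)))
mainTheorem14 zero () l
mainTheorem14 (suc n₀) 1≤n l = Basis.isBasis n₀ l , λ k i j 1≤j j≤i i≤n →
  trans (γρ∇B-entry (suc n₀) (toℕ k) (l k) 1≤n i j 1≤j j≤i i≤n) (sym (bit-sum₃ _ _ _ _ _ _))
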